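{- $\mathcal{L}(\mathcal{S})\equiv\mathcal{L}(\mathcal{F})$, where $\mathcal{S}$ is the since operator and $\mathcal{F}$ is the flip-flop operator.
   Context: Write $\mathbb{B}=\{0,1\}$. Static formulas are built from propositional variables and $\top,\bot$ using $\neg,\land,\lor$. An operator automaton is $\mathcal{A}=\langle \mathbb{B}^m,[1,n],\delta,q_{\mathrm{init}}\rangle$ with $\delta:[1,n]\times\mathbb{B}^m\to[1,n]$, $q_{\mathrm{init}}\in[1,n]$. Rules: static $p \;{:}{ - }\; \alpha$; delay $p \;{:}{ - }\; \ominus q$; dynamic $p_1,\dots,p_n \;{:}{ - }\; \mathcal{A}(a_1,\dots,a_m)$. A program is a finite set of rules that is nonrecursive (the graph with an edge $a\to b$ whenever $a$ occurs in the body and $b$ in the head of a rule is acyclic) and definitorial (each variable is in at most one head). Non-defined variables are input variables; an interpretation is a finite non-empty sequence $I=I_1,\dots,I_\ell$ of subsets of input variables. Satisfaction $(P,I,t)\models\cdot$: $\top$ holds, $\bot$ not; input $a$ holds iff $a\in I_t$; Boolean connectives as usual; $p$ defined by $p\;{:}{ - }\;\alpha$ iff $(P,I,t)\models\alpha$; $p$ defined by $p\;{:}{ - }\;\ominus q$ iff $(P,I,t-1)\models q$; for $p_i$ defined by a dynamic rule, $(P,I,0)\models p_i$ iff $q_{\mathrm{init}}=i$, and for $t>0$, $(P,I,t)\models p_i$ iff there are $j$ and $\sigma\in\mathbb{B}^m$ (an assignment to $a_1,\dots,a_m$, identified with the conjunction of literals it makes true) with $\delta(j,\sigma)=i$, $(P,I,t-1)\models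 p_j$, $(P,I,t)\models\sigma$. $\mathcal{L}(\mathbf{A})$ is the set of programs with static rules, delay rules and dynamic rules with operators from $\mathbf{A}$. A program with ordered input variables and a designated variable $a$ recognises the language of strings $\sigma_1\dots\sigma_\ell$ over $\mathbb{B}^m$ (letters read as assignments to the input variables) with $(P,I,\ell)\models a$; the expressivity of a logic is the set of languages its programs recognise; $\mathcal{L}_1\equiv\mathcal{L}_2$ means the two expressivities coincide. The since operator is $\mathcal{S}=\langle\mathbb{B}^2,\{1,2\},\delta,1\rangle$ with $\delta(q,10)=q$, $\delta(q,01)=\delta(q,11)=2$, $\delta(q,00)=1$. The flip-flop operator is $\mathcal{F}=\langle\mathbb{B}^2,\{1,2\},\delta,1\rangle$ with $\delta(q,00)=q$, $\delta(q,10)=\delta(q,11)=2$, $\delta(q,01)=1$. -}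

module Defs where

open import Data.Nat using (ℕ; zero; suc; _≤_; _≡ᵇ_)
open import Data.Bool using (Bool; true; false; not; _∧_; _∨_; if_then_else_)
open import Data.Fin using (Fin) renaming (zero to f0; suc to fs)
import Data.Fin as Fin
open import Data.Vec using (Vec; []; _∷_; lookup; toList) renaming (map to vmap)
open import Data.List using (List; []; _∷_; length; _++_; concatMap)
open import Data.Maybe using (Maybe; just; nothing; maybe)
open import Data.Product using (Σ; ∃; _×_; _,_; ∃-syntax)
open import Data.Empty using (⊥)
open import Data.Sum using (_⊎_)
open import Relation.Nullary using (¬_)
open import Relation.Nullary.Decidable using (⌊_⌋)
open import Relation.Binary.PropositionalEquality using (_≡_)
open import Relation.Binary.Construct.Closure.Transitive using (TransClosure)
open import Data.List.Membership.Propositional using (_∈_)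
open import Data.List.Relation.Unary.Unique.Propositional using (Unique)
open import Function.Bundles using (_⇔_)

Var : Set
Var = ℕ

data Formula : Set where
  var  : Var → Formula
  ⊤f   : Formula
  ⊥f   : Formula
  ¬f_  : Formula → Formula
  _∧f_ : Formula → Formula → Formula
  _∨f_ : Formula → Formula → Formula

fvars : Formula → List Var
fvars (var x)   = x ∷ []
fvars ⊤f        = []
fvars ⊥f        = []
fvars (¬f α)    = fvars α
fvars (α ∧f β)  = fvars α ++ fvars β
fvars (α ∨f β)  = fvars α ++ fvars β

eval : (Var → Bool) → Formula → Bool
eval v (var x)  = v x
eval v ⊤f       = true
eval v ⊥f       = false
eval v (¬f α)   = not (eval v α)
eval v (α ∧f β) = eval v α ∧ eval v β
eval v (α ∨f β) = eval v α ∨ eval v β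

-- Operator automaton ⟨ B^m , [1,n] , δ , q_init ⟩ ; state i of the paper is Fin index i-1.
record Automaton : Set where
  field
    m     : ℕ
    n     : ℕ
    δ     : Fin n → Vec Bool m → Fin n
    qinit : Fin n

-- Letters σ ∈ B^2 are written a₁a₂ in the paper; here a₁ ∷ a₂ ∷ [].
since-δ : Fin 2 → Vec Bool 2 → Fin 2
since-δ q (true  ∷ false ∷ []) = q
since-δ q (false ∷ true  ∷ []) = fs f0
since-δ q (true  ∷ true  ∷ []) = fs f0
since-δ q (false ∷ false ∷ []) = f0

flipflop-δ : Fin 2 → Vec Bool 2 → Fin 2
flipflop-δ q (false ∷ false ∷ []) = q
flipflop-δ q (true  ∷ false ∷ []) = fs f0
flipflop-δ q (true  ∷ true  ∷ []) = fs f0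
flipflop-δ q (false ∷ true  ∷ []) = f0

Since : Automaton
Since = record { m = 2 ; n = 2 ; δ = since-δ ; qinit = f0 }

FlipFlop : Automaton
FlipFlop = record { m = 2 ; n = 2 ; δ = flipflop-δ ; qinit = f0 }

-- Rules whose dynamic rules use the operator A (so programs over A are L({A})).
data Rule (A : Automaton) : Set where
  static : Var → Formula → Rule A
  delay  : Var → Var → Rule A
  dyn    : Vec Var (Automaton.n A) → Vec Var (Automaton.m A) → Rule A

Program : Automaton → Set
Program A = List (Rule A)

heads : ∀ {A} → Rule A → List Var
heads (static p _) = p ∷ []
heads (delay p _)  = p ∷ []
heads (dyn ps _)   = toList ps

body : ∀ {A} → Rule A → List Var
body (static _ α) = fvars α
body (delay _ q)  = q ∷ []
body (dyn _ as)   = toList as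

Defined : ∀ {A} → Program A → Var → Set
Defined P x = ∃[ r ] (r ∈ P × x ∈ heads r)

Occurs : ∀ {A} → Program A → Var → Set
Occurs P x = ∃[ r ] (r ∈ P × (x ∈ heads r ⊎ x ∈ body r))

Edge : ∀ {A} → Program A → Var → Var → Set
Edge P a b = ∃[ r ] (r ∈ P × a ∈ body r × b ∈ heads r)

NonRecursive : ∀ {A} → Program A → Set
NonRecursive P = ∀ x → ¬ TransClosure (Edge P) x x

Definitorial : ∀ {A} → Program A → Set
Definitorial P = Unique (concatMap heads P)

inVal : ∀ {m} → Vec Var m → Vec Bool m → Var → Bool
inVal []       []       x = false
inVal (y ∷ ys) (b ∷ bs) x = if x ≡ᵇ y then b else inVal ys bs x

index : ∀ {X : Set} → List X → ℕ → Maybe X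
index []       _       = nothing
index (a ∷ w)  zero    = just a
index (a ∷ w)  (suc t) = index w t

-- Input at time t (letters are σ₁ … σ_ℓ; time 0 has no letter: all inputs false)
inputAt : ∀ {m} → Vec Var m → List (Vec Bool m) → ℕ → Var → Bool
inputAt xs w zero    x = false
inputAt xs w (suc t) x = maybe (λ σ → inVal xs σ x) false (index w t)

Valuation : Set
Valuation = ℕ → Var → Bool

RuleSat : ∀ {A} → ℕ → Valuation → Rule A → Set
RuleSat ℓ V (static p α) = ∀ t → t ≤ ℓ → V t p ≡ eval (V t) α
RuleSat ℓ V (delay p q)  = V 0 p ≡ false × (∀ t → suc t ≤ ℓ → V (suc t) p ≡ V t q)
RuleSat {A} ℓ V (dyn ps as) =
  ∀ (i : Fin (Automaton.n A)) →
    (V 0 (lookup ps i) ≡ ⌊ i Fin.≟ Automaton.qinit A ⌋)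
    × (∀ t → suc t ≤ ℓ →
         (V (suc t) (lookup ps i) ≡ true) ⇔
         (∃[ j ] Σ (Vec Bool (Automaton.m A)) λ σ →
              Automaton.δ A j σ ≡ i
            × V t (lookup ps j) ≡ true
            × σ ≡ vmap (V (suc t)) as))

record Recogniser (A : Automaton) (m : ℕ) : Set where
  field
    prog     : Program A
    inputs   : Vec Var m
    out      : Var
    nonrec   : NonRecursive prog
    definit  : Definitorial prog
    inputs-distinct  : Unique (toList inputs)
    inputs-undefined : ∀ x → x ∈ toList inputs → ¬ Defined prog x
    inputs-complete  : ∀ x → Occurs prog x → ¬ Defined prog x → x ∈ toList inputs
    out-ok   : Defined prog out ⊎ out ∈ toList inputs

Consistent : ∀ {A m} → Recogniser A m → List (Vec Bool m) → Valuation → Set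
Consistent R w V =
    (∀ t → t ≤ length w → ∀ x → ¬ Defined prog x → V t x ≡ inputAt inputs w t x)
  × (∀ r → r ∈ prog → RuleSat (length w) V r)
  where open Recogniser R

Accepts : ∀ {A m} → Recogniser A m → List (Vec Bool m) → Set
Accepts R w = (w ≢ []) × ∃[ V ] (Consistent R w V × V (length w) (Recogniser.out R) ≡ true)
  where
  _≢_ : ∀ {X : Set} → X → X → Set
  a ≢ b = ¬ (a ≡ b)

_⊑_ : Automaton → Automaton → Set
A ⊑ B = ∀ m (R : Recogniser A m) → Σ (Recogniser B m) λ R′ → ∀ w → Accepts R w ⇔ Accepts R′ w

_≋_ : Automaton → Automaton → Set
A ≋ B = (A ⊑ B) × (B ⊑ A)

-- Each operator simulates the other up to negating one argument:
-- S(a₁,a₂) = F(a₂,¬a₁) and F(b₁,b₂) = S(¬b₂,b₁), letter by letter.  A program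
-- over one operator is therefore translated into one over the other by
-- renaming every variable x to 2x and adding, for each argument a of a
-- dynamic rule, a fresh variable 2a+1 defined by the static rule 2a+1 :- ¬2a.
-- The translation stays nonrecursive and definitorial, and consistent
-- valuations of the two programs correspond on the even variables.
module Submission where

open import Defs
open import Data.Nat using (ℕ; zero; suc; _≤_; _≡ᵇ_)
open import Data.Nat.Properties using (_≟_; suc-injective; ≡ᵇ⇒≡; ≡⇒≡ᵇ)
open import Data.Bool using (Bool; true; false; not; _∧_; _∨_; T)
open import Data.Fin using (Fin) renaming (zero to f0; suc to fs)
open import Data.Vec using (Vec; []; _∷_; lookup; toList) renaming (map to vmap)
open import Data.Vec.Properties using (toList-map; lookup-map; map-∘; map-cong)
open import Data.Vec.Membership.Propositional.Properties using (∈-lookup; ∈-toList⁺)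
open import Data.List using (List; []; _∷_; _++_; map; concatMap; deduplicate)
open import Data.List.Properties using (map-++; concatMap-++; concatMap-map; concatMap-cong; concatMap-pure; map-concatMap)
open import Data.List.Membership.Propositional using (_∈_; _∉_; find)
open import Data.List.Membership.DecPropositional _≟_ using (_∈?_)
open import Data.List.Membership.Propositional.Properties
  using (∈-map⁺; ∈-map⁻; ∈-++⁺ˡ; ∈-++⁺ʳ; ∈-++⁻; ∈-concatMap⁺; ∈-concatMap⁻; ∈-deduplicate⁺; ∈-deduplicate⁻)
open import Data.List.Relation.Unary.Any using (here; there)
import Data.List.Relation.Unary.Any as Any
open import Data.List.Relation.Unary.Unique.Propositional using (Unique)
open import Data.List.Relation.Unary.Unique.DecPropositional.Properties _≟_ using (map⁺; ++⁺; deduplicate-!)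
open import Data.Product using (Σ; ∃-syntax; _×_; _,_)
open import Data.Product.Function.NonDependent.Propositional using (_×-⇔_)
open import Data.Empty using (⊥-elim)
open import Data.Sum using (_⊎_; inj₁; inj₂)
open import Data.Unit using (tt)
open import Data.Maybe using (just; nothing)
open import Function using (_∘_; id)
open import Function.Bundles using (_⇔_; mk⇔; Equivalence)
import Function.Properties.Equivalence as ⇔
open import Relation.Nullary using (¬_; does)
open import Relation.Nullary.Decidable using (dec-true; dec-false)
open import Relation.Binary.PropositionalEquality
open import Relation.Binary.Construct.Closure.Transitive using (TransClosure; [_]; _∷_)

-- Splitting the variables into copies and negated copies

copy : Var → Var
copy zero    = zero
copy (suc x) = suc (suc (copy x))

negCopy : Var → Var
negCopy a = suc (copy a)

copy-injective : ∀ {x y} → copy x ≡ copy y → x ≡ y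
copy-injective {zero}  {zero}  refl = refl
copy-injective {suc x} {suc y} e    = cong suc (copy-injective (suc-injective (suc-injective e)))

negCopy-injective : ∀ {x y} → negCopy x ≡ negCopy y → x ≡ y
negCopy-injective = copy-injective ∘ suc-injective

copy≢negCopy : ∀ {x y} → copy x ≢ negCopy y
copy≢negCopy {suc x} {suc y} e = copy≢negCopy (suc-injective (suc-injective e))

data CopyView : Var → Set where
  copy-of    : ∀ x → CopyView (copy x)
  negCopy-of : ∀ a → CopyView (negCopy a)

copyView : ∀ x → CopyView x
copyView zero = copy-of zero
copyView (suc x) with copyView x
... | copy-of y    = negCopy-of y
... | negCopy-of a = copy-of (suc a)

caseParity : {X : Set} → (Var → X) → (Var → X) → Var → X
caseParity f g zero          = f zero
caseParity f g (suc zero)    = g zero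
caseParity f g (suc (suc x)) = caseParity (f ∘ suc) (g ∘ suc) x

caseParity-copy : ∀ {X : Set} (f g : Var → X) x → caseParity f g (copy x) ≡ f x
caseParity-copy f g zero    = refl
caseParity-copy f g (suc x) = caseParity-copy (f ∘ suc) (g ∘ suc) x

caseParity-negCopy : ∀ {X : Set} (f g : Var → X) a → caseParity f g (negCopy a) ≡ g a
caseParity-negCopy f g zero    = refl
caseParity-negCopy f g (suc a) = caseParity-negCopy (f ∘ suc) (g ∘ suc) a

rename : (Var → Var) → Formula → Formula
rename f (var x)  = var (f x)
rename f ⊤f       = ⊤f
rename f ⊥f       = ⊥f
rename f (¬f α)   = ¬f rename f α
rename f (α ∧f β) = rename f α ∧f rename f β
rename f (α ∨f β) = rename f α ∨f rename f β

eval-rename : ∀ v f α → eval v (rename f α) ≡ eval (v ∘ f) α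
eval-rename v f (var x)  = refl
eval-rename v f ⊤f       = refl
eval-rename v f ⊥f       = refl
eval-rename v f (¬f α)   = cong not (eval-rename v f α)
eval-rename v f (α ∧f β) = cong₂ _∧_ (eval-rename v f α) (eval-rename v f β)
eval-rename v f (α ∨f β) = cong₂ _∨_ (eval-rename v f α) (eval-rename v f β)

eval-cong : ∀ {v u} → (∀ x → v x ≡ u x) → ∀ α → eval v α ≡ eval u α
eval-cong e (var x)  = e x
eval-cong e ⊤f       = refl
eval-cong e ⊥f       = refl
eval-cong e (¬f α)   = cong not (eval-cong e α)
eval-cong e (α ∧f β) = cong₂ _∧_ (eval-cong e α) (eval-cong e β)
eval-cong e (α ∨f β) = cong₂ _∨_ (eval-cong e α) (eval-cong e β)

fvars-rename : ∀ f α → fvars (rename f α) ≡ map f (fvars α)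
fvars-rename f (var x)  = refl
fvars-rename f ⊤f       = refl
fvars-rename f ⊥f       = refl
fvars-rename f (¬f α)   = fvars-rename f α
fvars-rename f (α ∧f β) = trans (cong₂ _++_ (fvars-rename f α) (fvars-rename f β)) (sym (map-++ f (fvars α) (fvars β)))
fvars-rename f (α ∨f β) = trans (cong₂ _++_ (fvars-rename f α) (fvars-rename f β)) (sym (map-++ f (fvars α) (fvars β)))

≡ᵇ-injective : ∀ {f : Var → Var} → (∀ {x y} → f x ≡ f y → x ≡ y) → ∀ x y → (f x ≡ᵇ f y) ≡ (x ≡ᵇ y)
≡ᵇ-injective {f} f-inj x y with x ≡ᵇ y in e | f x ≡ᵇ f y in e′
... | true  | true  = refl
... | false | false = refl
... | true  | false = ⊥-elim (subst T e′ (≡⇒≡ᵇ (f x) (f y) (cong f (≡ᵇ⇒≡ x y (subst T (sym e) tt)))))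
... | false | true  = ⊥-elim (subst T e (≡⇒≡ᵇ x y (f-inj (≡ᵇ⇒≡ (f x) (f y) (subst T (sym e′) tt)))))

inVal-map : ∀ {f : Var → Var} → (∀ {x y} → f x ≡ f y → x ≡ y) →
            ∀ {m} (ys : Vec Var m) σ x → inVal (vmap f ys) σ (f x) ≡ inVal ys σ x
inVal-map f-inj []       []       x = refl
inVal-map f-inj (y ∷ ys) (b ∷ bs) x rewrite ≡ᵇ-injective f-inj x y with x ≡ᵇ y
... | true  = refl
... | false = inVal-map f-inj ys bs x

inVal-∉ : ∀ {m} (ys : Vec Var m) σ {x} → x ∉ toList ys → inVal ys σ x ≡ false
inVal-∉ []       []       x∉ = refl
inVal-∉ (y ∷ ys) (b ∷ bs) {x} x∉ with x ≡ᵇ y in e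
... | true  = ⊥-elim (x∉ (here (≡ᵇ⇒≡ x y (subst T (sym e) tt))))
... | false = inVal-∉ ys bs (x∉ ∘ there)

inputAt-map : ∀ {f : Var → Var} → (∀ {x y} → f x ≡ f y → x ≡ y) →
              ∀ {m} (ys : Vec Var m) w t x → inputAt (vmap f ys) w t (f x) ≡ inputAt ys w t x
inputAt-map f-inj ys w zero    x = refl
inputAt-map f-inj ys w (suc t) x with index w t
... | nothing = refl
... | just σ  = inVal-map f-inj ys σ x

inputAt-∉ : ∀ {m} (ys : Vec Var m) w t {x} → x ∉ toList ys → inputAt ys w t x ≡ false
inputAt-∉ ys w zero    x∉ = refl
inputAt-∉ ys w (suc t) x∉ with index w t
... | nothing = refl
... | just σ  = inVal-∉ ys σ x∉

Π-⇔ : ∀ {I : Set} {P Q : I → Set} → (∀ i → P i ⇔ Q i) → (∀ i → P i) ⇔ (∀ i → Q i)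
Π-⇔ e = mk⇔ (λ f i → Equivalence.to (e i) (f i)) (λ g i → Equivalence.from (e i) (g i))

≡-⇔ : ∀ {X : Set} {x x′ y y′ : X} → x ≡ x′ → y ≡ y′ → (x ≡ y) ⇔ (x′ ≡ y′)
≡-⇔ refl refl = ⇔.refl

⇔-cong : ∀ {P P′ Q Q′ : Set} → P ⇔ P′ → Q ⇔ Q′ → (P ⇔ Q) ⇔ (P′ ⇔ Q′)
⇔-cong eP eQ = mk⇔ (λ h → ⇔.trans (⇔.sym eP) (⇔.trans h eQ)) (λ h → ⇔.trans eP (⇔.trans h (⇔.sym eQ)))

data Literal (m : ℕ) : Set where
  pos neg : Fin m → Literal m

literalVal : ∀ {m} → Vec Bool m → Literal m → Bool
literalVal σ (pos i) = lookup σ i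
literalVal σ (neg i) = not (lookup σ i)

literalVar : ∀ {m} → Vec Var m → Literal m → Var
literalVar as (pos i) = copy (lookup as i)
literalVar as (neg i) = negCopy (lookup as i)

literalVar-val : ∀ {m} (v u : Var → Bool) (as : Vec Var m) →
                 (∀ i → v (copy (lookup as i)) ≡ u (lookup as i)) →
                 (∀ i → v (negCopy (lookup as i)) ≡ not (u (lookup as i))) →
                 ∀ l → v (literalVar as l) ≡ literalVal (vmap u as) l
literalVar-val v u as c n (pos i) = trans (c i) (sym (lookup-map i u as))
literalVar-val v u as c n (neg i) = trans (n i) (cong not (sym (lookup-map i u as)))

-- Translating programs between operators related by a literal substitution

module Translation {m m′ n : ℕ} (δA : Fin n → Vec Bool m → Fin n) (δB : Fin n → Vec Bool m′ → Fin n)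
                   (q : Fin n) (τ : Vec (Literal m) m′)
                   (simulates : ∀ j σ → δB j (vmap (literalVal σ) τ) ≡ δA j σ) where

  A B : Automaton
  A = record { m = m ; n = n ; δ = δA ; qinit = q }
  B = record { m = m′ ; n = n ; δ = δB ; qinit = q }

  transition-⇔ : ∀ {s s′ : Fin n → Bool} {c : Vec Bool m} {c′ : Vec Bool m′} i →
           (∀ j → s′ j ≡ s j) → c′ ≡ vmap (literalVal c) τ →
           (∃[ j ] Σ (Vec Bool m) λ σ → δA j σ ≡ i × s j ≡ true × σ ≡ c) ⇔
           (∃[ j ] Σ (Vec Bool m′) λ σ → δB j σ ≡ i × s′ j ≡ true × σ ≡ c′)
  transition-⇔ i s≡ c≡ = mk⇔
    (λ { (j , _ , δ≡ , sj , refl) → j , _ , trans (cong (δB j) c≡) (trans (simulates j _) δ≡) , trans (s≡ j) sj , refl })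
    (λ { (j , _ , δ≡ , sj , refl) → j , _ , trans (sym (simulates j _)) (trans (cong (δB j) (sym c≡)) δ≡) , trans (sym (s≡ j)) sj , refl })

  translate : Rule A → Rule B
  translate (static p α) = static (copy p) (rename copy α)
  translate (delay p q)  = delay (copy p) (copy q)
  translate (dyn ps as)  = dyn (vmap copy ps) (vmap (literalVar as) τ)

  negationRule : Var → Rule B
  negationRule a = static (negCopy a) (¬f var (copy a))

  dynArgs : Rule A → List Var
  dynArgs (static _ _) = []
  dynArgs (delay _ _)  = []
  dynArgs (dyn _ as)   = toList as

  dynArgs⊆body : ∀ r {a} → a ∈ dynArgs r → a ∈ body r
  dynArgs⊆body (dyn _ _) a∈ = a∈

  negated : Program A → List Var
  negated P = deduplicate _≟_ (concatMap dynArgs P)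

  ⟦_⟧ : Program A → Program B
  ⟦ P ⟧ = map translate P ++ map negationRule (negated P)

  module _ {P : Program A} where

    negated⁺ : ∀ {r a} → r ∈ P → a ∈ dynArgs r → a ∈ negated P
    negated⁺ r∈ a∈ = ∈-deduplicate⁺ _≟_ (∈-concatMap⁺ dynArgs (Any.map (λ { refl → a∈ }) r∈))

    negated⁻ : ∀ {a} → a ∈ negated P → ∃[ r ] (r ∈ P × a ∈ dynArgs r)
    negated⁻ a∈ = find (∈-concatMap⁻ dynArgs (∈-deduplicate⁻ _≟_ (concatMap dynArgs P) a∈))

    data TranslatedRule : Rule B → Set where
      translated : ∀ {r} → r ∈ P → TranslatedRule (translate r)
      negation   : ∀ {a} → a ∈ negated P → TranslatedRule (negationRule a)

    ∈-⟦⟧⁻ : ∀ {r′} → r′ ∈ ⟦ P ⟧ → TranslatedRule r′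
    ∈-⟦⟧⁻ r′∈ with ∈-++⁻ (map translate P) r′∈
    ... | inj₁ r′∈₁ with ∈-map⁻ translate r′∈₁
    ...   | _ , r∈ , refl = translated r∈
    ∈-⟦⟧⁻ r′∈ | inj₂ r′∈₂ with ∈-map⁻ negationRule r′∈₂
    ...   | _ , a∈ , refl = negation a∈

    translate∈⟦⟧ : ∀ {r} → r ∈ P → translate r ∈ ⟦ P ⟧
    translate∈⟦⟧ r∈ = ∈-++⁺ˡ (∈-map⁺ translate r∈)

    negationRule∈⟦⟧ : ∀ {a} → a ∈ negated P → negationRule a ∈ ⟦ P ⟧
    negationRule∈⟦⟧ a∈ = ∈-++⁺ʳ (map translate P) (∈-map⁺ negationRule a∈)

  heads-translate : ∀ r → heads (translate r) ≡ map copy (heads r)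
  heads-translate (static _ _) = refl
  heads-translate (delay _ _)  = refl
  heads-translate (dyn ps _)   = toList-map copy ps

  ∈-heads-translate⁻ : ∀ r {x} → x ∈ heads (translate r) → ∃[ y ] (y ∈ heads r × x ≡ copy y)
  ∈-heads-translate⁻ r x∈ = ∈-map⁻ copy (subst (_ ∈_) (heads-translate r) x∈)

  data TranslatedBodyVar (r : Rule A) : Var → Set where
    copied    : ∀ {z} → z ∈ body r → TranslatedBodyVar r (copy z)
    negCopied : ∀ {z} → z ∈ dynArgs r → TranslatedBodyVar r (negCopy z)

  ∈-body-translate⁻ : ∀ r {x} → x ∈ body (translate r) → TranslatedBodyVar r x
  ∈-body-translate⁻ (static p α) x∈ with ∈-map⁻ copy (subst (_ ∈_) (fvars-rename copy α) x∈)
  ... | _ , z∈ , refl = copied z∈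
  ∈-body-translate⁻ (delay p q) (here refl) = copied (here refl)
  ∈-body-translate⁻ (dyn ps as) = literals τ
    where
    literals : ∀ {k} (τ′ : Vec (Literal m) k) {x} → x ∈ toList (vmap (literalVar as) τ′) → TranslatedBodyVar (dyn ps as) x
    literals (pos i ∷ _) (here refl) = copied (∈-toList⁺ (∈-lookup i as))
    literals (neg i ∷ _) (here refl) = negCopied (∈-toList⁺ (∈-lookup i as))
    literals (_ ∷ τ′) (there x∈) = literals τ′ x∈

  module _ {P : Program A} where

    Defined-copy⁺ : ∀ {y} → Defined P y → Defined ⟦ P ⟧ (copy y)
    Defined-copy⁺ (r , r∈ , y∈) = translate r , translate∈⟦⟧ r∈ , subst (_ ∈_) (sym (heads-translate r)) (∈-map⁺ copy y∈)

    Defined-copy⁻ : ∀ {y} → Defined ⟦ P ⟧ (copy y) → Defined P y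
    Defined-copy⁻ (r′ , r′∈ , y∈) with ∈-⟦⟧⁻ r′∈
    ... | translated {r} r∈ with ∈-heads-translate⁻ r y∈
    ...   | _ , y′∈ , e = r , r∈ , subst (_∈ heads r) (sym (copy-injective e)) y′∈
    Defined-copy⁻ (r′ , r′∈ , here e) | negation _ = ⊥-elim (copy≢negCopy e)

    Defined-negCopy⁺ : ∀ {a} → a ∈ negated P → Defined ⟦ P ⟧ (negCopy a)
    Defined-negCopy⁺ a∈ = negationRule _ , negationRule∈⟦⟧ {P = P} a∈ , here refl

  -- Every edge of ⟦ P ⟧ halves to an edge of P, except the edges 2c → 2c+1
  -- into negated copies, which cannot be composed with each other.

  base : Var → Var
  base = caseParity id id

  base-∈-body : ∀ r {x} → TranslatedBodyVar r x → base x ∈ body r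
  base-∈-body r (copied {z} z∈)    = subst (_∈ body r) (sym (caseParity-copy id id z)) z∈
  base-∈-body r (negCopied {z} z∈) = subst (_∈ body r) (sym (caseParity-negCopy id id z)) (dynArgs⊆body r z∈)

  NegationEdge : Var → Var → Set
  NegationEdge a b = ∃[ c ] (a ≡ copy c × b ≡ negCopy c)

  module _ {P : Program A} where

    edge-⟦⟧ : ∀ {a b} → Edge ⟦ P ⟧ a b → Edge P (base a) (base b) ⊎ NegationEdge a b
    edge-⟦⟧ (r′ , r′∈ , a∈ , b∈) with ∈-⟦⟧⁻ r′∈
    ... | translated {r} r∈ with ∈-heads-translate⁻ r b∈
    ...   | y , y∈ , refl = inj₁ (r , r∈ , base-∈-body r (∈-body-translate⁻ r a∈)
                                     , subst (_∈ heads r) (sym (caseParity-copy id id y)) y∈)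
    edge-⟦⟧ (_ , _ , here refl , here refl) | negation {c} _ = inj₂ (c , refl , refl)

    path-⟦⟧ : ∀ {a b} → TransClosure (Edge ⟦ P ⟧) a b → TransClosure (Edge P) (base a) (base b) ⊎ NegationEdge a b
    path-⟦⟧ [ e ] with edge-⟦⟧ e
    ... | inj₁ e′ = inj₁ [ e′ ]
    ... | inj₂ ne = inj₂ ne
    path-⟦⟧ (e ∷ p) with edge-⟦⟧ e | path-⟦⟧ p
    ... | inj₁ e′ | inj₁ p′ = inj₁ (e′ ∷ p′)
    ... | inj₁ e′ | inj₂ (c , refl , refl) =
          inj₁ [ subst (Edge P _) (trans (caseParity-copy id id c) (sym (caseParity-negCopy id id c))) e′ ]
    ... | inj₂ (c , refl , refl) | inj₁ p′ =
          inj₁ (subst (λ x → TransClosure (Edge P) x _) (trans (caseParity-negCopy id id c) (sym (caseParity-copy id id c))) p′)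
    ... | inj₂ (_ , _ , e₁) | inj₂ (_ , e₂ , _) = ⊥-elim (copy≢negCopy (trans (sym e₂) e₁))

    nonRecursive-⟦⟧ : NonRecursive P → NonRecursive ⟦ P ⟧
    nonRecursive-⟦⟧ nr x cycle with path-⟦⟧ cycle
    ... | inj₁ p            = nr (base x) p
    ... | inj₂ (_ , e₁ , e₂) = copy≢negCopy (trans (sym e₁) e₂)

    heads-⟦⟧ : concatMap heads ⟦ P ⟧ ≡ map copy (concatMap heads P) ++ map negCopy (negated P)
    heads-⟦⟧ = begin
      concatMap heads ⟦ P ⟧
        ≡⟨ concatMap-++ heads (map translate P) (map negationRule (negated P)) ⟩
      concatMap heads (map translate P) ++ concatMap heads (map negationRule (negated P))
        ≡⟨ cong₂ _++_ translated-heads negation-heads ⟩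
      map copy (concatMap heads P) ++ map negCopy (negated P) ∎
      where
      open ≡-Reasoning
      translated-heads : concatMap heads (map translate P) ≡ map copy (concatMap heads P)
      translated-heads = trans (concatMap-map heads translate P)
                               (trans (concatMap-cong heads-translate P) (sym (map-concatMap copy heads P)))
      negation-heads : concatMap heads (map negationRule (negated P)) ≡ map negCopy (negated P)
      negation-heads = trans (concatMap-map heads negationRule (negated P))
                             (trans (sym (concatMap-map (_∷ []) negCopy (negated P))) (concatMap-pure (map negCopy (negated P))))

    definitorial-⟦⟧ : Definitorial P → Definitorial ⟦ P ⟧
    definitorial-⟦⟧ d = subst Unique (sym heads-⟦⟧)
      (++⁺ (map⁺ copy-injective d) (map⁺ negCopy-injective (deduplicate-! _)) disjoint)
      where
      disjoint : ∀ {v} → ¬ (v ∈ map copy (concatMap heads P) × v ∈ map negCopy (negated P))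
      disjoint (v∈₁ , v∈₂) with ∈-map⁻ copy v∈₁ | ∈-map⁻ negCopy v∈₂
      ... | _ , _ , refl | _ , _ , e = copy≢negCopy e

  module _ (ℓ : ℕ) (V V′ : Valuation) (agree : ∀ t x → V′ t (copy x) ≡ V t x) where

    translate-⇔ : ∀ r → (∀ t → t ≤ ℓ → ∀ a → a ∈ dynArgs r → V′ t (negCopy a) ≡ not (V t a)) →
                  RuleSat ℓ V r ⇔ RuleSat ℓ V′ (translate r)
    translate-⇔ (static p α) _ = Π-⇔ λ t → Π-⇔ λ _ →
      ≡-⇔ (sym (agree t p)) (sym (trans (eval-rename (V′ t) copy α) (eval-cong (agree t) α)))
    translate-⇔ (delay p q) _ =
      ≡-⇔ (sym (agree 0 p)) refl ×-⇔ (Π-⇔ λ t → Π-⇔ λ _ → ≡-⇔ (sym (agree (suc t) p)) (sym (agree t q)))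
    translate-⇔ (dyn ps as) negates = Π-⇔ λ i →
      ≡-⇔ (sym (agreeAt 0 i)) refl ×-⇔
      (Π-⇔ λ t → Π-⇔ λ le → ⇔-cong (≡-⇔ (sym (agreeAt (suc t) i)) refl) (transition-⇔ i (agreeAt t) (arguments (suc t) le)))
      where
      agreeAt : ∀ t i → V′ t (lookup (vmap copy ps) i) ≡ V t (lookup ps i)
      agreeAt t i = trans (cong (V′ t) (lookup-map i copy ps)) (agree t (lookup ps i))
      arguments : ∀ t → t ≤ ℓ → vmap (V′ t) (vmap (literalVar as) τ) ≡ vmap (literalVal (vmap (V t) as)) τ
      arguments t le = trans (sym (map-∘ (V′ t) (literalVar as) τ))
        (map-cong (literalVar-val (V′ t) (V t) as (λ i → agree t (lookup as i))
                                  (λ i → negates t le (lookup as i) (∈-toList⁺ (∈-lookup i as)))) τ)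

  module _ {k : ℕ} (R : Recogniser A k) where
    open Recogniser R

    copyInputs : Vec Var k
    copyInputs = vmap copy inputs

    ∈-copyInputs⁺ : ∀ {y} → y ∈ toList inputs → copy y ∈ toList copyInputs
    ∈-copyInputs⁺ y∈ = subst (_ ∈_) (sym (toList-map copy inputs)) (∈-map⁺ copy y∈)

    ∈-copyInputs⁻ : ∀ {x} → x ∈ toList copyInputs → ∃[ y ] (y ∈ toList inputs × x ≡ copy y)
    ∈-copyInputs⁻ x∈ = ∈-map⁻ copy (subst (_ ∈_) (toList-map copy inputs) x∈)

    copy-input : ∀ {z} → Occurs prog z → ¬ Defined ⟦ prog ⟧ (copy z) → copy z ∈ toList copyInputs
    copy-input o nd = ∈-copyInputs⁺ (inputs-complete _ o (nd ∘ Defined-copy⁺))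

    inputs-complete-⟦⟧ : ∀ x → Occurs ⟦ prog ⟧ x → ¬ Defined ⟦ prog ⟧ x → x ∈ toList copyInputs
    inputs-complete-⟦⟧ x (r′ , r′∈ , inj₁ x∈) nd = ⊥-elim (nd (r′ , r′∈ , x∈))
    inputs-complete-⟦⟧ x (r′ , r′∈ , inj₂ x∈) nd with ∈-⟦⟧⁻ r′∈
    ... | translated {r} r∈ = from-body (∈-body-translate⁻ r x∈) nd
      where
      from-body : ∀ {x} → TranslatedBodyVar r x → ¬ Defined ⟦ prog ⟧ x → x ∈ toList copyInputs
      from-body (copied z∈)    nd = copy-input (r , r∈ , inj₂ z∈) nd
      from-body (negCopied z∈) nd = ⊥-elim (nd (Defined-negCopy⁺ {P = prog} (negated⁺ r∈ z∈)))
    inputs-complete-⟦⟧ x (r′ , r′∈ , inj₂ (here refl)) nd | negation a∈ with negated⁻ a∈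
    ... | r , r∈ , a∈dyn = copy-input (r , r∈ , inj₂ (dynArgs⊆body r a∈dyn)) nd

    ⟦_⟧ᴿ : Recogniser B k
    ⟦_⟧ᴿ = record
      { prog             = ⟦ prog ⟧
      ; inputs           = copyInputs
      ; out              = copy out
      ; nonrec           = nonRecursive-⟦⟧ nonrec
      ; definit          = definitorial-⟦⟧ {P = prog} definit
      ; inputs-distinct  = subst Unique (sym (toList-map copy inputs)) (map⁺ copy-injective inputs-distinct)
      ; inputs-undefined = λ x x∈ d → let y , y∈ , e = ∈-copyInputs⁻ x∈ in
                                       inputs-undefined y y∈ (Defined-copy⁻ (subst (Defined ⟦ prog ⟧) e d))
      ; inputs-complete  = inputs-complete-⟦⟧
      ; out-ok           = Data.Sum.map Defined-copy⁺ ∈-copyInputs⁺ out-ok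
      }

    restrict : Valuation → Valuation
    restrict V′ t x = V′ t (copy x)

    -- A negated copy that ⟦ prog ⟧ does not define is an input variable read
    -- from no letter, so it has to stay false.
    extend : Valuation → Valuation
    extend V t = caseParity (V t) (λ a → does (a ∈? negated prog) ∧ not (V t a))

    extend-copy : ∀ V t x → extend V t (copy x) ≡ V t x
    extend-copy V t = caseParity-copy (V t) _

    extend-negCopy : ∀ V t {a} → a ∈ negated prog → extend V t (negCopy a) ≡ not (V t a)
    extend-negCopy V t {a} a∈ = trans (caseParity-negCopy (V t) _ a) (cong (_∧ not (V t a)) (dec-true (a ∈? _) a∈))

    extend-negCopy-∉ : ∀ V t {a} → a ∉ negated prog → extend V t (negCopy a) ≡ false
    extend-negCopy-∉ V t {a} a∉ = trans (caseParity-negCopy (V t) _ a) (cong (_∧ not (V t a)) (dec-false (a ∈? _) a∉))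

    module _ (w : List (Vec Bool k)) where

      restrict-consistent : ∀ {V′} → Consistent ⟦_⟧ᴿ w V′ → Consistent R w (restrict V′)
      restrict-consistent {V′} (inp , rules) =
        (λ t le x nd → trans (inp t le (copy x) (nd ∘ Defined-copy⁻)) (inputAt-map copy-injective inputs w t x)) ,
        (λ r r∈ → Equivalence.from (translate-⇔ _ (restrict V′) V′ (λ _ _ → refl) r (negates r∈)) (rules _ (translate∈⟦⟧ r∈)))
        where
        negates : ∀ {r} → r ∈ prog → ∀ t → t ≤ _ → ∀ a → a ∈ dynArgs r → V′ t (negCopy a) ≡ not (V′ t (copy a))
        negates r∈ t le a a∈ = rules _ (negationRule∈⟦⟧ {P = prog} (negated⁺ r∈ a∈)) t le

      extend-consistent : ∀ {V} → Consistent R w V → Consistent ⟦_⟧ᴿ w (extend V)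
      extend-consistent {V} (inp , rules) = inp′ , rules′
        where
        inp′ : ∀ t → t ≤ _ → ∀ x → ¬ Defined ⟦ prog ⟧ x → extend V t x ≡ inputAt copyInputs w t x
        inp′ t le x nd with copyView x
        ... | copy-of y = trans (extend-copy V t y)
                            (trans (inp t le y (nd ∘ Defined-copy⁺)) (sym (inputAt-map copy-injective inputs w t y)))
        ... | negCopy-of a = trans (extend-negCopy-∉ V t (nd ∘ Defined-negCopy⁺ {P = prog}))
                                   (sym (inputAt-∉ copyInputs w t not-input))
          where
          not-input : negCopy a ∉ toList copyInputs
          not-input a∈ = let _ , _ , e = ∈-copyInputs⁻ a∈ in copy≢negCopy (sym e)

        rules′ : ∀ r′ → r′ ∈ ⟦ prog ⟧ → RuleSat _ (extend V) r′
        rules′ r′ r′∈ with ∈-⟦⟧⁻ r′∈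
        ... | translated {r} r∈ = Equivalence.to (translate-⇔ _ V (extend V) (extend-copy V) r
                                    (λ t _ a a∈ → extend-negCopy V t (negated⁺ r∈ a∈))) (rules r r∈)
        ... | negation {a} a∈ = λ t _ → trans (extend-negCopy V t a∈) (cong not (sym (extend-copy V t a)))

      accepts-⟦⟧ : Accepts R w ⇔ Accepts ⟦_⟧ᴿ w
      accepts-⟦⟧ = mk⇔
        (λ { (ne , V , c , o) → ne , extend V , extend-consistent c , trans (extend-copy V _ out) o })
        (λ { (ne , V′ , c′ , o) → ne , restrict V′ , restrict-consistent c′ , o })

  simulation : A ⊑ B
  simulation k R = ⟦ R ⟧ᴿ , accepts-⟦⟧ R

flipflop-simulates-since : ∀ j σ → flipflop-δ j (vmap (literalVal σ) (pos (fs f0) ∷ neg f0 ∷ [])) ≡ since-δ j σ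
flipflop-simulates-since j (true  ∷ true  ∷ []) = refl
flipflop-simulates-since j (true  ∷ false ∷ []) = refl
flipflop-simulates-since j (false ∷ true  ∷ []) = refl
flipflop-simulates-since j (false ∷ false ∷ []) = refl

since-simulates-flipflop : ∀ j σ → since-δ j (vmap (literalVal σ) (neg (fs f0) ∷ pos f0 ∷ [])) ≡ flipflop-δ j σ
since-simulates-flipflop j (true  ∷ true  ∷ []) = refl
since-simulates-flipflop j (true  ∷ false ∷ []) = refl
since-simulates-flipflop j (false ∷ true  ∷ []) = refl
since-simulates-flipflop j (false ∷ false ∷ []) = refl

theorem10 : Since ≋ FlipFlop
theorem10 = Translation.simulation since-δ flipflop-δ f0 (pos (fs f0) ∷ neg f0 ∷ []) flipflop-simulates-since
          , Translation.simulation flipflop-δ since-δ f0 (neg (fs f0) ∷ pos f0 ∷ []) since-simulates-flipflop
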